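{- There exists a language $L\subseteq\{0,1\}^*$ with $L\in\mathrm{L}\cap\mathrm{REG}/n$ such that both $L$ and $\{0,1\}^*-L$ are $\mathrm{REG}$-immune (i.e., $L$ is $\mathrm{REG}$-bi-immune).
   Context: $\mathrm{L}$ is the family of languages decidable by deterministic Turing machines with a read-only input tape and logarithmic-space work tape. $\mathrm{REG}/n$ is the family of languages $L$ over $\Sigma$ for which there exist an alphabet $\Gamma$, $h:\mathbb{N}\to\Gamma^*$ with $|h(n)|=n$, and a regular language $A$ over $\Sigma\times\Gamma$ with $x\in L$ iff $\left[\begin{smallmatrix}x\\ h(|x|)\end{smallmatrix}\right]\in A$ for all $x\in\Sigma^*$, where $\left[\begin{smallmatrix}x_1\cdots x_n\\ y_1\cdots y_n\end{smallmatrix}\right]=(x_1,y_1)\cdots(x_n,y_n)$. A language is $\mathrm{REG}$-immune if it is infinite and has no infinite regular subset. -}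

module Defs where

open import Data.Nat using (ℕ; zero; suc; _+_; _*_; _≤_; _<ᵇ_; pred)
open import Data.Nat.Logarithm using (⌊log₂_⌋)
open import Data.Bool using (Bool; true; false; if_then_else_)
open import Data.Fin using (Fin)
import Data.Fin as Fin
open import Data.List using (List; []; _∷_; foldl; length; zip)
open import Data.Vec using (Vec; toList)
open import Data.Product using (Σ; _×_; _,_; ∃)
open import Data.Nat using (_≟_)
open import Relation.Nullary using (¬_; yes; no)
open import Relation.Binary.PropositionalEquality using (_≡_)
open import Function.Bundles using (_⇔_)
open import Data.List.Membership.Propositional using (_∉_)

Lang : Set → Set₁
Lang A = List A → Set

-- Binary words {0,1}^* : 0 ↦ false, 1 ↦ true.
Word : Set
Word = List Bool

Complement : Lang Bool → Lang Bool
Complement L w = ¬ L w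

_⊆_ : {A : Set} → Lang A → Lang A → Set
P ⊆ Q = ∀ w → P w → Q w

record DFA (A : Set) : Set where
  field
    states : ℕ
    start  : Fin states
    δ      : Fin states → A → Fin states
    acc    : Fin states → Bool

accepts : {A : Set} → DFA A → List A → Set
accepts D w = DFA.acc D (foldl (DFA.δ D) (DFA.start D) w) ≡ true

Regular : {A : Set} → Lang A → Set
Regular {A} P = Σ (DFA A) λ D → ∀ w → P w ⇔ accepts D w

Infinite : {A : Set} → Lang A → Set
Infinite P = ∀ (xs : List _) → ∃ λ w → P w × w ∉ xs

REGImmune : Lang Bool → Set₁
REGImmune L = Infinite L × (∀ (R : Lang Bool) → Regular R → R ⊆ L → ¬ Infinite R)

InREGn : Lang Bool → Set₁
InREGn L =
  Σ ℕ λ m →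
  Σ ((n : ℕ) → Vec (Fin m) n) λ h →
  Σ (Lang (Bool × Fin m)) λ A →
    Regular A × (∀ (x : Word) → L x ⇔ A (zip x (toList (h (length x)))))

-- Deterministic Turing machines with a read-only two-way input tape
-- (with end markers) and one semi-infinite read/write work tape.

data InSym : Set where
  lend rend : InSym
  bit       : Bool → InSym

data Move : Set where
  left stay right : Move

data Action (Q G : ℕ) : Set where
  halt : Bool → Action Q G                                  -- halt, accept (true) / reject (false)
  go   : Fin Q → Fin (suc G) → Move → Move → Action Q G     -- new state, written symbol, input move, work move

record TM : Set where
  field
    Q     : ℕ
    G     : ℕ                    -- work alphabet Fin (suc G); zero = blank
    start : Fin Q
    δ     : Fin Q → InSym → Fin (suc G) → Action Q G

-- Input tape for x of length n: cell 0 = left marker, cells 1..n = x, cell n+1 = right marker.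
readBody : Word → ℕ → InSym
readBody []       _       = rend
readBody (b ∷ _)  zero    = bit b
readBody (_ ∷ bs) (suc i) = readBody bs i

readIn : Word → ℕ → InSym
readIn x zero    = lend
readIn x (suc i) = readBody x i

moveIn : ℕ → Move → ℕ → ℕ
moveIn n left  i = pred i
moveIn n stay  i = i
moveIn n right i = if i <ᵇ suc n then suc i else i

moveWork : Move → ℕ → ℕ
moveWork left  j = pred j
moveWork stay  j = j
moveWork right j = suc j

module _ (M : TM) where
  open TM M

  record Config : Set where
    constructor cfg
    field
      state : Fin Q
      inPos : ℕ
      wkPos : ℕ
      tape  : ℕ → Fin (suc G)

  data Status : Set where
    running : Config → Status
    halted  : Bool → Status

  write : (ℕ → Fin (suc G)) → ℕ → Fin (suc G) → ℕ → Fin (suc G)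
  write t j a k with k ≟ j
  ... | yes _ = a
  ... | no  _ = t k

  step : Word → Status → Status
  step x (halted b) = halted b
  step x (running (cfg q i j t)) with δ q (readIn x i) (t j)
  ... | halt b = halted b
  ... | go q′ a mi mw = running (cfg q′ (moveIn (length x) mi i) (moveWork mw j) (write t j a))

  initial : Status
  initial = running (cfg start 0 0 (λ _ → Fin.zero))

  run : Word → ℕ → Status
  run x zero    = initial
  run x (suc t) = step x (run x t)

  Decides : Lang Bool → Set
  Decides L = ∀ (x : Word) → Σ ℕ λ t → Σ Bool λ b → run x t ≡ halted b × (L x ⇔ (b ≡ true))

  LogSpace : Set
  LogSpace = Σ ℕ λ c → ∀ (x : Word) (t : ℕ) (κ : Config) →
    run x t ≡ running κ → Config.wkPos κ ≤ c * ⌊log₂ (length x) ⌋ + c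

InL : Lang Bool → Set
InL L = Σ TM λ M → Decides M L × LogSpace M

-- L consists of the words whose length has an odd number of binary digits, i.e. the
-- lengths in the blocks [2^E, 2^(E+1)) with E even.  Membership depends only on the
-- length, so one advice bit per length (repeated along the word) puts L in REG/n, and a
-- machine deciding L only has to count the input length in binary on its work tape,
-- which takes logarithmic space.  By pumping, an infinite regular language contains words
-- of every length a + i·p for some p > 0; the blocks eventually outgrow p, so such a
-- progression meets blocks of both parities, and neither L nor its complement can
-- contain an infinite regular language.
module Submission where

open import Defs
open import Data.Bool using (Bool; true; false; not; if_then_else_)
open import Data.Bool.Properties using (¬-not; not-¬) renaming (_≟_ to _≟ᵇ_)
open import Data.Nat
open import Data.Nat.Properties
open import Data.Nat.Logarithm using (⌊log₂_⌋; ⌊log₂⌋-mono-≤; ⌊log₂[2^n]⌋≡n)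
open import Data.Fin using (Fin; toℕ)
import Data.Fin as Fin
open import Data.Fin.Properties using (pigeonhole; toℕ<n)
open import Data.List using (List; []; _∷_; length; _++_; foldl; map; take; drop; replicate; zip)
open import Data.List.Properties
  using (length-++; length-replicate; foldl-++; ++-assoc; take++drop≡id; take-take; length-take; length-drop)
open import Data.List.Extrema.Nat using (argmax; f[xs]≤f[argmax])
open import Data.List.Membership.Propositional using (_∈_)
open import Data.List.Membership.Propositional.Properties using (∈-++⁺ˡ; ∈-++⁺ʳ; ∈-map⁺)
import Data.List.Relation.Unary.All as All
open import Data.List.Relation.Unary.Any using (here)
open import Data.Vec as Vec using (Vec)
open import Data.Product using (Σ; _×_; _,_; ∃; ∃₂; proj₁; proj₂)
open import Data.Sum using (inj₁; inj₂)
open import Function using (_∘_; id)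
open import Function.Bundles using (_⇔_; mk⇔; Equivalence)
open import Relation.Binary.PropositionalEquality
open import Relation.Nullary using (¬_; yes; no; contradiction)

-- Binary length

odd : ℕ → Bool
odd zero    = false
odd (suc n) = not (odd n)

-- Binary numerals are bit lists, least significant bit first.
inc : List Bool → List Bool
inc []           = true ∷ []
inc (false ∷ bs) = true ∷ bs
inc (true  ∷ bs) = false ∷ inc bs

bin : ℕ → List Bool
bin zero    = []
bin (suc n) = inc (bin n)

bitLength : ℕ → ℕ
bitLength n = length (bin n)

value : List Bool → ℕ
value []       = 0
value (b ∷ bs) = (if b then 1 else 0) + 2 * value bs

value-inc : ∀ bs → value (inc bs) ≡ suc (value bs)
value-inc []           = refl
value-inc (false ∷ bs) = refl
value-inc (true  ∷ bs) = begin
  2 * value (inc bs)     ≡⟨ cong (2 *_) (value-inc bs) ⟩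
  2 * suc (value bs)     ≡⟨ *-suc 2 (value bs) ⟩
  2 + 2 * value bs       ∎
  where open ≡-Reasoning

value-bin : ∀ n → value (bin n) ≡ n
value-bin zero    = refl
value-bin (suc n) = trans (value-inc (bin n)) (cong suc (value-bin n))

value<2^length : ∀ bs → value bs < 2 ^ length bs
value<2^length []       = s≤s z≤n
value<2^length (b ∷ bs) = begin-strict
  (if b then 1 else 0) + 2 * value bs ≤⟨ +-monoˡ-≤ _ (bit≤1 b) ⟩
  1 + 2 * value bs                   <⟨ n<1+n _ ⟩
  2 + 2 * value bs                   ≡⟨ *-suc 2 (value bs) ⟨
  2 * suc (value bs)                 ≤⟨ *-monoʳ-≤ 2 (value<2^length bs) ⟩
  2 * 2 ^ length bs                  ∎
  where
  open ≤-Reasoning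
  bit≤1 : ∀ b → (if b then 1 else 0) ≤ 1
  bit≤1 true  = ≤-refl
  bit≤1 false = z≤n

data Trimmed : List Bool → Set where
  []  : Trimmed []
  one : Trimmed (true ∷ [])
  _∷_ : ∀ b {c cs} → Trimmed (c ∷ cs) → Trimmed (b ∷ c ∷ cs)

inc-trimmed : ∀ {bs} → Trimmed bs → Trimmed (inc bs)
inc-trimmed []                   = one
inc-trimmed one                  = false ∷ one
inc-trimmed (false ∷ t)          = true ∷ t
inc-trimmed (true ∷ one)         = false ∷ (false ∷ one)
inc-trimmed (true ∷ (false ∷ t)) = false ∷ (true ∷ t)
inc-trimmed (true ∷ (true ∷ t))  = false ∷ inc-trimmed (true ∷ t)

bin-trimmed : ∀ n → Trimmed (bin n)
bin-trimmed zero    = []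
bin-trimmed (suc n) = inc-trimmed (bin-trimmed n)

2^length≤value : ∀ {bs L} → Trimmed bs → length bs ≡ suc L → 2 ^ L ≤ value bs
2^length≤value {L = zero}  one       refl = ≤-refl
2^length≤value {b ∷ bs} {suc L} (b ∷ t) eq =
  ≤-trans (*-monoʳ-≤ 2 (2^length≤value t (suc-injective eq))) (m≤n+m _ (if b then 1 else 0))

2^≤bitLength : ∀ {n L} → bitLength n ≡ suc L → 2 ^ L ≤ n
2^≤bitLength {n} {L} eq = subst (2 ^ L ≤_) (value-bin n) (2^length≤value (bin-trimmed n) eq)

<2^bitLength : ∀ n → n < 2 ^ bitLength n
<2^bitLength n = subst (_< 2 ^ bitLength n) (value-bin n) (value<2^length (bin n))

2^-cancel-< : ∀ {m n} → 2 ^ m < 2 ^ n → m < n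
2^-cancel-< {m} {n} lt with m <? n
... | yes m<n = m<n
... | no m≮n  = contradiction lt (≤⇒≯ (^-monoʳ-≤ 2 (≮⇒≥ m≮n)))

bitLength-band : ∀ {m E} → 2 ^ E ≤ m → m < 2 ^ suc E → bitLength m ≡ suc E
bitLength-band {m} {E} lo hi with bitLength m in eq
... | zero  =
  contradiction (subst (λ k → m < 2 ^ k) eq (<2^bitLength m)) (≤⇒≯ (≤-trans (m^n>0 2 E) lo))
... | suc L = cong suc (≤-antisym (≤-pred L<1+E) (≤-pred E<1+L))
  where
  L<1+E : L < suc E
  L<1+E = 2^-cancel-< (≤-<-trans (2^≤bitLength eq) hi)
  E<1+L : E < suc L
  E<1+L = 2^-cancel-< (≤-<-trans lo (subst (λ k → m < 2 ^ k) eq (<2^bitLength m)))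

bitLength≤1+⌊log₂⌋ : ∀ n → bitLength n ≤ suc ⌊log₂ n ⌋
bitLength≤1+⌊log₂⌋ n with bitLength n in eq
... | zero  = z≤n
... | suc L = s≤s (subst (_≤ ⌊log₂ n ⌋) (⌊log₂[2^n]⌋≡n L) (⌊log₂⌋-mono-≤ (2^≤bitLength {n} eq)))

length≤length-inc : ∀ bs → length bs ≤ length (inc bs)
length≤length-inc []           = z≤n
length≤length-inc (false ∷ bs) = ≤-refl
length≤length-inc (true  ∷ bs) = s≤s (length≤length-inc bs)

bitLength-mono-≤ : ∀ {m n} → m ≤ n → bitLength m ≤ bitLength n
bitLength-mono-≤ {n = zero}  z≤n = z≤n
bitLength-mono-≤ {n = suc n} m≤1+n with m≤n⇒m<n∨m≡n m≤1+n
... | inj₁ m<1+n = ≤-trans (bitLength-mono-≤ (≤-pred m<1+n)) (length≤length-inc (bin n))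
... | inj₂ refl  = ≤-refl

-- Arithmetic progressions and dyadic blocks

n<2^n : ∀ n → n < 2 ^ n
n<2^n zero    = s≤s z≤n
n<2^n (suc n) = +-mono-≤-< (m^n>0 2 n) (≤-trans (n<2^n n) (m≤m+n _ 0))

multiple-in-window : ∀ {p} → 0 < p → ∀ d → ∃ λ i → d ≤ i * p × i * p < d + p
multiple-in-window p>0 zero = 0 , z≤n , p>0
multiple-in-window {p} p>0 (suc d) with multiple-in-window p>0 d
... | i , d≤ip , ip<d+p with m≤n⇒m<n∨m≡n d≤ip
...   | inj₁ d<ip = i , d<ip , m<n⇒m<1+n ip<d+p
...   | inj₂ refl = suc i , +-monoˡ-≤ (i * p) p>0 , subst (_< suc (i * p) + p) (+-comm (i * p) p) ≤-refl

progression-meets-band : ∀ {a p E} → 0 < p → a + p ≤ 2 ^ E → ∃ λ i → bitLength (a + i * p) ≡ suc E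
progression-meets-band {a} {p} {E} p>0 a+p≤2^E with multiple-in-window p>0 (2 ^ E ∸ a)
... | i , d≤ip , ip<d+p = i , bitLength-band lower upper
  where
  a≤2^E : a ≤ 2 ^ E
  a≤2^E = ≤-trans (m≤m+n a p) a+p≤2^E
  lower : 2 ^ E ≤ a + i * p
  lower = begin
    2 ^ E           ≡⟨ m+[n∸m]≡n a≤2^E ⟨
    a + (2 ^ E ∸ a) ≤⟨ +-monoʳ-≤ a d≤ip ⟩
    a + i * p       ∎
    where open ≤-Reasoning
  upper : a + i * p < 2 ^ suc E
  upper = begin-strict
    a + i * p             <⟨ +-monoʳ-< a ip<d+p ⟩
    a + (2 ^ E ∸ a + p)   ≡⟨ +-assoc a (2 ^ E ∸ a) p ⟨
    a + (2 ^ E ∸ a) + p   ≡⟨ cong (_+ p) (m+[n∸m]≡n a≤2^E) ⟩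
    2 ^ E + p             ≤⟨ +-monoʳ-≤ (2 ^ E) (≤-trans (m≤n+m p a) a+p≤2^E) ⟩
    2 ^ E + 2 ^ E         ≡⟨ cong (2 ^ E +_) (+-identityʳ (2 ^ E)) ⟨
    2 ^ suc E             ∎
    where open ≤-Reasoning

odd-takes-both-values : ∀ N b → ∃ λ E → N ≤ E × odd (suc E) ≡ b
odd-takes-both-values N b with odd (suc N) ≟ᵇ b
... | yes eq = N , ≤-refl , eq
... | no neq = suc N , n≤1+n N , sym (¬-not (≢-sym neq))

progression-meets-parity : ∀ {p} → 0 < p → ∀ a b → ∃ λ i → odd (bitLength (a + i * p)) ≡ b
progression-meets-parity {p} p>0 a b with odd-takes-both-values (a + p) b
... | E , a+p≤E , odd[1+E]≡b
  with progression-meets-band {a} {p} {E} p>0 (≤-trans a+p≤E (<⇒≤ (n<2^n E)))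
...   | i , len≡1+E = i , trans (cong odd len≡1+E) odd[1+E]≡b

-- Immunity

words : ℕ → List Word
words zero    = [] ∷ []
words (suc n) = map (true ∷_) (words n) ++ map (false ∷_) (words n)

∈-words : ∀ w → w ∈ words (length w)
∈-words []          = here refl
∈-words (true  ∷ w) = ∈-++⁺ˡ (∈-map⁺ (true ∷_) (∈-words w))
∈-words (false ∷ w) = ∈-++⁺ʳ (map (true ∷_) (words (length w))) (∈-map⁺ (false ∷_) (∈-words w))

wordsShorterThan : ℕ → List Word
wordsShorterThan zero    = []
wordsShorterThan (suc k) = words k ++ wordsShorterThan k

∈-wordsShorterThan : ∀ {k} w → length w < k → w ∈ wordsShorterThan k
∈-wordsShorterThan {suc k} w lt with m≤n⇒m<n∨m≡n (≤-pred lt)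
... | inj₁ shorter = ∈-++⁺ʳ (words k) (∈-wordsShorterThan w shorter)
... | inj₂ refl    = ∈-++⁺ˡ (∈-words w)

Unbounded : Lang Bool → Set
Unbounded P = ∀ k → ∃ λ w → P w × k ≤ length w

infinite⇒unbounded : ∀ {P} → Infinite P → Unbounded P
infinite⇒unbounded inf k with inf (wordsShorterThan k)
... | w , Pw , w∉ = w , Pw , ≮⇒≥ (w∉ ∘ ∈-wordsShorterThan w)

unbounded⇒infinite : ∀ {P} → Unbounded P → Infinite P
unbounded⇒infinite unb ws with unb (suc (length (argmax length [] ws)))
... | w , Pw , long = w , Pw , λ w∈ws → <⇒≱ long (All.lookup (f[xs]≤f[argmax] [] ws) w∈ws)

repeat : ∀ {A : Set} → ℕ → List A → List A
repeat zero    y = []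
repeat (suc i) y = y ++ repeat i y

length-repeat : ∀ {A : Set} i (y : List A) → length (repeat i y) ≡ i * length y
length-repeat zero    y = refl
length-repeat (suc i) y = trans (length-++ y) (cong (length y +_) (length-repeat i y))

module _ {A S : Set} (δ : S → A → S) where

  foldl-repeat : ∀ {q} y i → foldl δ q y ≡ q → foldl δ q (repeat i y) ≡ q
  foldl-repeat y zero    loop = refl
  foldl-repeat {q} y (suc i) loop = begin
    foldl δ q (y ++ repeat i y)         ≡⟨ foldl-++ δ q y (repeat i y) ⟩
    foldl δ (foldl δ q y) (repeat i y)  ≡⟨ cong (λ q′ → foldl δ q′ (repeat i y)) loop ⟩
    foldl δ q (repeat i y)              ≡⟨ foldl-repeat y i loop ⟩
    q                                   ∎
    where open ≡-Reasoning

  foldl-pump : ∀ s x y z i → foldl δ (foldl δ s x) y ≡ foldl δ s x →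
               foldl δ s (x ++ repeat i y ++ z) ≡ foldl δ s (x ++ y ++ z)
  foldl-pump s x y z i loop = begin
    foldl δ s (x ++ repeat i y ++ z)           ≡⟨ foldl-++ δ s x _ ⟩
    foldl δ (foldl δ s x) (repeat i y ++ z)    ≡⟨ foldl-++ δ _ (repeat i y) z ⟩
    foldl δ (foldl δ q (repeat i y)) z         ≡⟨ cong (λ q′ → foldl δ q′ z) (foldl-repeat y i loop) ⟩
    foldl δ q z                                ≡⟨ cong (λ q′ → foldl δ q′ z) loop ⟨
    foldl δ (foldl δ q y) z                    ≡⟨ foldl-++ δ q y z ⟨
    foldl δ q (y ++ z)                         ≡⟨ foldl-++ δ s x (y ++ z) ⟨
    foldl δ s (x ++ y ++ z)                    ∎
    where
    open ≡-Reasoning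
    q : S
    q = foldl δ s x

module _ {A : Set} (D : DFA A) where
  open DFA D

  pumping : ∀ w → states ≤ length w →
    ∃ λ x → ∃₂ λ y z → w ≡ x ++ y ++ z × 0 < length y ×
      foldl δ (foldl δ start x) y ≡ foldl δ start x
  pumping w states≤∣w∣ with pigeonhole (n<1+n states) (λ k → foldl δ start (take (toℕ k) w))
  ... | i , j , i<j , same = x , y , z , decomposition , 0<∣y∣ , loop
    where
    a b : ℕ
    a = toℕ i
    b = toℕ j
    u x y z : List A
    u = take b w
    x = take a u
    y = drop a u
    z = drop b w
    x≡take-a : x ≡ take a w
    x≡take-a = trans (take-take a b w) (cong (λ k → take k w) (m≤n⇒m⊓n≡m (<⇒≤ i<j)))
    decomposition : w ≡ x ++ y ++ z
    decomposition = begin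
      w              ≡⟨ take++drop≡id b w ⟨
      u ++ z         ≡⟨ cong (_++ z) (take++drop≡id a u) ⟨
      (x ++ y) ++ z  ≡⟨ ++-assoc x y z ⟩
      x ++ y ++ z    ∎
      where open ≡-Reasoning
    0<∣y∣ : 0 < length y
    0<∣y∣ = subst (0 <_) (sym ∣y∣≡b∸a) (m<n⇒0<n∸m i<j)
      where
      b≤∣w∣ : b ≤ length w
      b≤∣w∣ = ≤-trans (≤-pred (toℕ<n j)) states≤∣w∣
      ∣y∣≡b∸a : length y ≡ b ∸ a
      ∣y∣≡b∸a = trans (length-drop a u) (cong (_∸ a) (trans (length-take b w) (m≤n⇒m⊓n≡m b≤∣w∣)))
    loop : foldl δ (foldl δ start x) y ≡ foldl δ start x
    loop = begin
      foldl δ (foldl δ start x) y  ≡⟨ foldl-++ δ start x y ⟨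
      foldl δ start (x ++ y)       ≡⟨ cong (foldl δ start) (take++drop≡id a u) ⟩
      foldl δ start u              ≡⟨ same ⟨
      foldl δ start (take a w)     ≡⟨ cong (foldl δ start) x≡take-a ⟨
      foldl δ start x              ∎
      where open ≡-Reasoning

infinite-regular⇒progression : ∀ {R : Lang Bool} → Regular R → Infinite R →
  ∃₂ λ a p → 0 < p × ∀ i → ∃ λ u → R u × length u ≡ a + i * p
infinite-regular⇒progression {R} (D , R⇔accepts) inf
  with w , Rw , long ← infinite⇒unbounded inf (DFA.states D)
  with x , y , z , w≡xyz , 0<∣y∣ , loop ← pumping D w long
  = length x + length z , length y , 0<∣y∣ , λ i → x ++ repeat i y ++ z , R-pumped i , length-pumped i
  where
  open DFA D
  open Equivalence
  R-pumped : ∀ i → R (x ++ repeat i y ++ z)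
  R-pumped i = from (R⇔accepts _) (begin
    acc (foldl δ start (x ++ repeat i y ++ z))  ≡⟨ cong acc (foldl-pump δ start x y z i loop) ⟩
    acc (foldl δ start (x ++ y ++ z))           ≡⟨ cong (acc ∘ foldl δ start) w≡xyz ⟨
    acc (foldl δ start w)                       ≡⟨ to (R⇔accepts w) Rw ⟩
    true                                        ∎)
    where open ≡-Reasoning
  length-pumped : ∀ i → length (x ++ repeat i y ++ z) ≡ length x + length z + i * length y
  length-pumped i = begin
    length (x ++ repeat i y ++ z)                   ≡⟨ length-++ x ⟩
    length x + length (repeat i y ++ z)             ≡⟨ cong (length x +_) (length-++ (repeat i y)) ⟩
    length x + (length (repeat i y) + length z)     ≡⟨ cong (λ k → length x + (k + length z)) (length-repeat i y) ⟩
    length x + (i * length y + length z)            ≡⟨ cong (length x +_) (+-comm (i * length y) (length z)) ⟩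
    length x + (length z + i * length y)            ≡⟨ +-assoc (length x) (length z) (i * length y) ⟨
    length x + length z + i * length y              ∎
    where open ≡-Reasoning

LengthParity : Bool → Lang Bool
LengthParity b w = odd (bitLength (length w)) ≡ b

LengthParity-REGImmune : ∀ b → REGImmune (LengthParity b)
LengthParity-REGImmune b = unbounded⇒infinite unbounded , no-infinite-regular-subset
  where
  unbounded : Unbounded (LengthParity b)
  unbounded k with i , odd≡b ← progression-meets-parity (s≤s z≤n) k b =
    replicate (k + i * 1) false ,
    subst (λ n → odd (bitLength n) ≡ b) (sym (length-replicate (k + i * 1))) odd≡b ,
    subst (k ≤_) (sym (length-replicate (k + i * 1))) (m≤m+n k (i * 1))
  no-infinite-regular-subset : ∀ R → Regular R → R ⊆ LengthParity b → ¬ Infinite R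
  no-infinite-regular-subset R reg R⊆L inf
    with a , p , 0<p , member ← infinite-regular⇒progression reg inf
    with i , odd≡¬b ← progression-meets-parity 0<p a (not b)
    with u , Ru , ∣u∣≡ ← member i
    = not-¬ refl (trans (sym (R⊆L u Ru)) (trans (cong (odd ∘ bitLength) ∣u∣≡) odd≡¬b))

REGImmune-cong : ∀ {P Q : Lang Bool} → (∀ w → P w ⇔ Q w) → REGImmune P → REGImmune Q
REGImmune-cong P⇔Q (inf , immune) =
  (λ ws → let w , Pw , w∉ws = inf ws in w , to (P⇔Q w) Pw , w∉ws) ,
  λ R reg R⊆Q → immune R reg (λ w → from (P⇔Q w) ∘ R⊆Q w)
  where open Equivalence

-- Advice

bitFin : Bool → Fin 2
bitFin false = Fin.zero
bitFin true  = Fin.suc Fin.zero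

firstAdviceBit : DFA (Bool × Fin 2)
firstAdviceBit = record { states = 3 ; start = Fin.zero ; δ = δ′ ; acc = acc′ }
  where
  δ′ : Fin 3 → Bool × Fin 2 → Fin 3
  δ′ Fin.zero    (_ , a) = Fin.suc a
  δ′ (Fin.suc q) _       = Fin.suc q
  acc′ : Fin 3 → Bool
  acc′ (Fin.suc (Fin.suc Fin.zero)) = true
  acc′ _                            = false

firstAdviceBit-absorbing : ∀ q w → foldl (DFA.δ firstAdviceBit) (Fin.suc q) w ≡ Fin.suc q
firstAdviceBit-absorbing q []      = refl
firstAdviceBit-absorbing q (_ ∷ w) = firstAdviceBit-absorbing q w

advice-accepted : ∀ a b w → a ≡ true ⇔ accepts firstAdviceBit ((b , bitFin a) ∷ w)
advice-accepted a b w rewrite firstAdviceBit-absorbing (bitFin a) w with a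
... | false = mk⇔ id id
... | true  = mk⇔ id id

LengthParity-REGn : InREGn (LengthParity true)
LengthParity-REGn = 2 , advice , accepts firstAdviceBit , (firstAdviceBit , λ _ → mk⇔ id id) , correct
  where
  advice : (n : ℕ) → Vec (Fin 2) n
  advice n = Vec.replicate n (bitFin (odd (bitLength n)))
  correct : ∀ x → LengthParity true x ⇔ accepts firstAdviceBit (zip x (Vec.toList (advice (length x))))
  correct []      = mk⇔ id id
  correct (b ∷ x) = advice-accepted _ b (zip x (Vec.toList (Vec.replicate (length x) _)))

-- Logarithmic space

module Step (M : TM) (x : Word) where
  open TM M

  step-go : ∀ {q i j t q′ a mi mw} → δ q (readIn x i) (t j) ≡ go q′ a mi mw →
            step M x (running (cfg q i j t)) ≡
              running (cfg q′ (moveIn (length x) mi i) (moveWork mw j) (write M t j a))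
  step-go eq rewrite eq = refl

  step-halt : ∀ {q i j t b} → δ q (readIn x i) (t j) ≡ halt b →
              step M x (running (cfg q i j t)) ≡ halted b
  step-halt eq rewrite eq = refl

-- A trace from the initial status to a halting one certifies that the machine halts and,
-- because the machine is deterministic, that every configuration it ever reaches satisfies P.
module Trace (M : TM) (x : Word) (P : Config M → Set) where

  infixr 5 _⟶⟨_⟩_
  infixr 4 _◅◅_

  data _↠_ : Status M → Status M → Set where
    ε      : ∀ {s} → s ↠ s
    _⟶⟨_⟩_ : ∀ {κ s′ s} → P κ → step M x (running κ) ≡ s′ → s′ ↠ s → running κ ↠ s

  _◅◅_ : ∀ {s₁ s₂ s₃} → s₁ ↠ s₂ → s₂ ↠ s₃ → s₁ ↠ s₃
  ε              ◅◅ tr′ = tr′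
  (p ⟶⟨ e ⟩ tr) ◅◅ tr′ = p ⟶⟨ e ⟩ (tr ◅◅ tr′)

  step-↠ : ∀ {s b} → s ↠ halted b → step M x s ↠ halted b
  step-↠ ε              = ε
  step-↠ (_ ⟶⟨ refl ⟩ tr) = tr

  run-↠ : ∀ {b} → initial M ↠ halted b → ∀ t → run M x t ↠ halted b
  run-↠ tr zero    = tr
  run-↠ tr (suc t) = step-↠ (run-↠ tr t)

  running-↠-P : ∀ {κ b} → running κ ↠ halted b → P κ
  running-↠-P (p ⟶⟨ _ ⟩ _) = p

  run-reaches : ∀ {s b} t → run M x t ≡ s → s ↠ halted b → ∃ λ t′ → run M x t′ ≡ halted b
  run-reaches t eq ε             = t , eq
  run-reaches t eq (_ ⟶⟨ e ⟩ tr) = run-reaches (suc t) (trans (cong (step M x) eq) e) tr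

InL-by-traces : ∀ {L : Lang Bool} (M : TM) (verdict : Word → Bool) (space : Word → ℕ) (c : ℕ) →
  (∀ x → space x ≤ c * ⌊log₂ (length x) ⌋ + c) →
  (∀ x → L x ⇔ verdict x ≡ true) →
  (∀ x → let open Trace M x (λ κ → Config.wkPos κ ≤ space x) in initial M ↠ halted (verdict x)) →
  InL L
InL-by-traces M verdict space c space≤log correct trace = M , decides , c , bounded
  where
  decides : Decides M _
  decides x with t , halts ← Trace.run-reaches M x _ 0 refl (trace x) = t , verdict x , halts , correct x
  bounded : ∀ x t κ → run M x t ≡ running κ → Config.wkPos κ ≤ c * ⌊log₂ (length x) ⌋ + c
  bounded x t κ eq =
    ≤-trans (running-↠-P (subst (_↠ halted (verdict x)) eq (run-↠ (trace x) t))) (space≤log x)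
    where open Trace M x _

pattern □ = Fin.zero
pattern ⊢ = Fin.suc Fin.zero
pattern 𝟘 = Fin.suc (Fin.suc Fin.zero)
pattern 𝟙 = Fin.suc (Fin.suc (Fin.suc Fin.zero))

pattern qStart  = Fin.zero
pattern qCount  = Fin.suc Fin.zero
pattern qCarry  = Fin.suc (Fin.suc Fin.zero)
pattern qReturn = Fin.suc (Fin.suc (Fin.suc Fin.zero))
pattern qEven   = Fin.suc (Fin.suc (Fin.suc (Fin.suc Fin.zero)))
pattern qOdd    = Fin.suc (Fin.suc (Fin.suc (Fin.suc (Fin.suc Fin.zero))))

-- The work tape holds ⊢ followed by the binary counter, least significant bit first.
-- For every input symbol the counter is incremented (carry to the right, then back to ⊢);
-- at the right end marker the parity of the counter's length is read off in qEven/qOdd.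
-- The halting clauses other than those on □ in qEven/qOdd are unreachable.
δ-parity : Fin 6 → InSym → Fin 4 → Action 6 3
δ-parity qStart  _       _ = go qCount ⊢ right right
δ-parity qCount  (bit _) s = go qCarry s right stay
δ-parity qCount  rend    s = go qEven s stay stay
δ-parity qCount  lend    _ = halt false
δ-parity qCarry  _       𝟙 = go qCarry 𝟘 stay right
δ-parity qCarry  _       𝟘 = go qReturn 𝟙 stay left
δ-parity qCarry  _       □ = go qReturn 𝟙 stay left
δ-parity qCarry  _       ⊢ = halt false
δ-parity qReturn _       𝟘 = go qReturn 𝟘 stay left
δ-parity qReturn _       ⊢ = go qCount ⊢ stay right
δ-parity qReturn _       _ = halt false
δ-parity qEven   _       □ = halt false
δ-parity qEven   _       s = go qOdd s stay right
δ-parity qOdd    _       □ = halt true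
δ-parity qOdd    _       s = go qEven s stay right

bitLengthParity : TM
bitLengthParity = record { Q = 6 ; G = 3 ; start = qStart ; δ = δ-parity }

bitSym : Bool → Fin 4
bitSym false = 𝟘
bitSym true  = 𝟙

headSym : List Bool → Fin 4
headSym []      = □
headSym (b ∷ _) = bitSym b

cellAt : List Bool → ℕ → Fin 4
cellAt []       _       = □
cellAt (b ∷ _)  zero    = bitSym b
cellAt (_ ∷ bs) (suc k) = cellAt bs k

Tape : Set
Tape = ℕ → Fin 4

tapeOf : List Bool → Tape
tapeOf bs zero    = ⊢
tapeOf bs (suc k) = cellAt bs k

Stores : Tape → List Bool → Set
Stores t bs = ∀ k → t k ≡ tapeOf bs k

zeros : ℕ → List Bool
zeros j = replicate j false

zeros-shift : ∀ j r → zeros j ++ false ∷ r ≡ zeros (suc j) ++ r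
zeros-shift zero    r = refl
zeros-shift (suc j) r = cong (false ∷_) (zeros-shift j r)

cellAt-zeros-++ : ∀ j r → cellAt (zeros j ++ r) j ≡ headSym r
cellAt-zeros-++ zero    []      = refl
cellAt-zeros-++ zero    (_ ∷ _) = refl
cellAt-zeros-++ (suc j) r = cellAt-zeros-++ j r

cellAt-zeros : ∀ {j k} r → k < j → cellAt (zeros j ++ r) k ≡ 𝟘
cellAt-zeros {suc j} {zero}  r k<j       = refl
cellAt-zeros {suc j} {suc k} r (s≤s k<j) = cellAt-zeros r k<j

cellAt-zeros-++-≢ : ∀ j r b {k} → k ≢ j → cellAt (zeros j ++ r) k ≡ cellAt (zeros j ++ b ∷ drop 1 r) k
cellAt-zeros-++-≢ zero    []      b {zero}  k≢j = contradiction refl k≢j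
cellAt-zeros-++-≢ zero    (_ ∷ _) b {zero}  k≢j = contradiction refl k≢j
cellAt-zeros-++-≢ zero    []      b {suc k} k≢j = refl
cellAt-zeros-++-≢ zero    (_ ∷ _) b {suc k} k≢j = refl
cellAt-zeros-++-≢ (suc j) r       b {zero}  k≢j = refl
cellAt-zeros-++-≢ (suc j) r       b {suc k} k≢j = cellAt-zeros-++-≢ j r b (k≢j ∘ cong suc)

cellAt-length : ∀ bs → cellAt bs (length bs) ≡ □
cellAt-length []       = refl
cellAt-length (_ ∷ bs) = cellAt-length bs

cellAt-< : ∀ {bs k} → k < length bs → ∃ λ b → cellAt bs k ≡ bitSym b
cellAt-< {b ∷ bs} {zero}  _         = b , refl
cellAt-< {b ∷ bs} {suc k} (s≤s k<n) = cellAt-< {bs} k<n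

Stores-write-same : ∀ {t bs j a} → Stores t bs → t j ≡ a → Stores (write bitLengthParity t j a) bs
Stores-write-same {j = j} st tj≡a k with k ≟ j
... | yes refl = trans (sym tj≡a) (st k)
... | no _     = st k

Stores-write-bit : ∀ {t} j r b → Stores t (zeros j ++ r) →
                   Stores (write bitLengthParity t (suc j) (bitSym b)) (zeros j ++ b ∷ drop 1 r)
Stores-write-bit j r b st k with k ≟ suc j
Stores-write-bit j r b st k       | yes refl = sym (cellAt-zeros-++ j (b ∷ drop 1 r))
Stores-write-bit j r b st zero    | no _     = st zero
Stores-write-bit j r b st (suc k) | no k≢1+j = trans (st (suc k)) (cellAt-zeros-++-≢ j r b (k≢1+j ∘ cong suc))

Stores-read-after-zeros : ∀ {t} j r → Stores t (zeros j ++ r) → t (suc j) ≡ headSym r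
Stores-read-after-zeros j r st = trans (st (suc j)) (cellAt-zeros-++ j r)

Stores-start : Stores (write bitLengthParity (λ _ → □) 0 ⊢) []
Stores-start k with k ≟ 0
Stores-start k       | yes refl = refl
Stores-start zero    | no 0≢0   = contradiction refl 0≢0
Stores-start (suc k) | no _     = refl

qParity : Bool → Fin 6
qParity false = qEven
qParity true  = qOdd

δ-parity-bit : ∀ p ι b → δ-parity (qParity p) ι (bitSym b) ≡ go (qParity (not p)) (bitSym b) stay right
δ-parity-bit false ι false = refl
δ-parity-bit false ι true  = refl
δ-parity-bit true  ι false = refl
δ-parity-bit true  ι true  = refl

δ-parity-blank : ∀ p ι → δ-parity (qParity p) ι □ ≡ halt p
δ-parity-blank false ι = refl
δ-parity-blank true  ι = refl

readIn-< : ∀ {x c} → c < length x → ∃ λ b → readIn x (suc c) ≡ bit b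
readIn-< {b ∷ x} {zero}  _         = b , refl
readIn-< {_ ∷ x} {suc c} (s≤s c<n) = readIn-< {x} c<n

readIn-end : ∀ x → readIn x (suc (length x)) ≡ rend
readIn-end []      = refl
readIn-end (_ ∷ x) = readIn-end x

moveIn-right : ∀ {n c} → c < n → moveIn n right (suc c) ≡ suc (suc c)
moveIn-right {n} {c} c<n with c <ᵇ n | <⇒<ᵇ c<n
... | true | _ = refl

j<length-zeros-++-inc : ∀ j r → j < length (zeros j ++ inc r)
j<length-zeros-++-inc zero    []          = s≤s z≤n
j<length-zeros-++-inc zero    (false ∷ r) = s≤s z≤n
j<length-zeros-++-inc zero    (true ∷ r)  = s≤s z≤n
j<length-zeros-++-inc (suc j) r           = s≤s (j<length-zeros-++-inc j r)

module Run (x : Word) where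
  n ℓ : ℕ
  n = length x
  ℓ = bitLength n

  open Step bitLengthParity x
  open Trace bitLengthParity x (λ κ → Config.wkPos κ ≤ suc ℓ) public

  scan : ∀ {i t} k j → Stores t (bin n) → j + k ≡ ℓ →
         running (cfg (qParity (odd j)) i (suc j) t) ↠ halted (odd ℓ)
  scan {i} {t} zero j st j+0≡ℓ =
    s≤s (≤-reflexive j≡ℓ) ⟶⟨ trans (step-halt reads-□) (cong (halted ∘ odd) j≡ℓ) ⟩ ε
    where
    j≡ℓ : j ≡ ℓ
    j≡ℓ = trans (sym (+-identityʳ j)) j+0≡ℓ
    cell≡□ : cellAt (bin n) j ≡ □
    cell≡□ = subst (λ m → cellAt (bin n) m ≡ □) (sym j≡ℓ) (cellAt-length (bin n))
    reads-□ : δ-parity (qParity (odd j)) (readIn x i) (t (suc j)) ≡ halt (odd j)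
    reads-□ = trans (cong (δ-parity _ _) (trans (st (suc j)) cell≡□)) (δ-parity-blank _ _)
  scan {i} {t} (suc k) j st j+1+k≡ℓ =
    s≤s (<⇒≤ j<ℓ) ⟶⟨ step-go reads-b ⟩
    scan k (suc j) (Stores-write-same st (trans (st (suc j)) cell≡b)) (trans (sym (+-suc j k)) j+1+k≡ℓ)
    where
    j<ℓ : j < ℓ
    j<ℓ = subst (j <_) j+1+k≡ℓ (m<m+n j (s≤s z≤n))
    b : Bool
    b = proj₁ (cellAt-< {bin n} j<ℓ)
    cell≡b : cellAt (bin n) j ≡ bitSym b
    cell≡b = proj₂ (cellAt-< {bin n} j<ℓ)
    reads-b : δ-parity (qParity (odd j)) (readIn x i) (t (suc j)) ≡
              go (qParity (not (odd j))) (bitSym b) stay right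
    reads-b = trans (cong (δ-parity _ _) (trans (st (suc j)) cell≡b)) (δ-parity-bit _ _ b)

  ResumesCounting : ℕ → List Bool → Status bitLengthParity → Set
  ResumesCounting i bs s = ∃ λ t → Stores t bs × s ↠ running (cfg qCount i 1 t)

  infixr 5 _⟶⟨_⟩ᴿ_
  _⟶⟨_⟩ᴿ_ : ∀ {κ s i bs} → Config.wkPos κ ≤ suc ℓ → step bitLengthParity x (running κ) ≡ s →
            ResumesCounting i bs s → ResumesCounting i bs (running κ)
  p ⟶⟨ e ⟩ᴿ (t , st , tr) = t , st , p ⟶⟨ e ⟩ tr

  return : ∀ {i bs} j t → Stores t bs → (∀ {k} → k < j → cellAt bs k ≡ 𝟘) → j ≤ suc ℓ →
           ResumesCounting i bs (running (cfg qReturn i j t))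
  return zero t st _ j≤ =
    j≤ ⟶⟨ step-go (cong (δ-parity qReturn _) (st 0)) ⟩ᴿ
    (_ , Stores-write-same st (st 0) , ε)
  return (suc j) t st zeros-below j≤ =
    j≤ ⟶⟨ step-go (cong (δ-parity qReturn _) reads-𝟘) ⟩ᴿ
    return j _ (Stores-write-same st reads-𝟘) (zeros-below ∘ m<n⇒m<1+n) (≤-trans (n≤1+n j) j≤)
    where
    reads-𝟘 : t (suc j) ≡ 𝟘
    reads-𝟘 = trans (st (suc j)) (zeros-below ≤-refl)

  carry-position≤ℓ : ∀ r j → length (zeros j ++ inc r) ≤ ℓ → j ≤ ℓ
  carry-position≤ℓ r j bound = <⇒≤ (<-≤-trans (j<length-zeros-++-inc j r) bound)

  carry-stop : ∀ {i} r j t → Stores t (zeros j ++ r) → length (zeros j ++ inc r) ≤ ℓ →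
               (∀ ι → δ-parity qCarry ι (headSym r) ≡ go qReturn 𝟙 stay left) →
               ResumesCounting i (zeros j ++ true ∷ drop 1 r) (running (cfg qCarry i (suc j) t))
  carry-stop r j t st bound stops =
    s≤s j≤ℓ ⟶⟨ step-go (trans (cong (δ-parity qCarry _) (Stores-read-after-zeros j r st)) (stops _)) ⟩ᴿ
    return j _ (Stores-write-bit j r true st) (cellAt-zeros _) (m≤n⇒m≤1+n j≤ℓ)
    where
    j≤ℓ : j ≤ ℓ
    j≤ℓ = carry-position≤ℓ r j bound

  carry : ∀ {i} r j t → Stores t (zeros j ++ r) → length (zeros j ++ inc r) ≤ ℓ →
          ResumesCounting i (zeros j ++ inc r) (running (cfg qCarry i (suc j) t))
  carry []          j t st bound = carry-stop [] j t st bound (λ _ → refl)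
  carry (false ∷ r) j t st bound = carry-stop (false ∷ r) j t st bound (λ _ → refl)
  carry (true ∷ r)  j t st bound =
    s≤s (carry-position≤ℓ (true ∷ r) j bound)
      ⟶⟨ step-go (cong (δ-parity qCarry _) (Stores-read-after-zeros j (true ∷ r) st)) ⟩ᴿ
    subst (λ bs → ResumesCounting _ bs _) (sym (zeros-shift j (inc r)))
      (carry r (suc j) _ (subst (Stores _) (zeros-shift j r) (Stores-write-bit j (true ∷ r) false st))
                         (subst (λ bs → length bs ≤ ℓ) (zeros-shift j (inc r)) bound))

  counting : ℕ → Tape → Status bitLengthParity
  counting c t = running (cfg qCount (suc c) 1 t)

  increment : ∀ {c t} → c < n → Stores t (bin c) →
              ResumesCounting (suc (suc c)) (bin (suc c)) (counting c t)
  increment {c} {t} c<n st =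
    s≤s z≤n ⟶⟨ trans (step-go reads-bit) (cong (λ i → running (cfg qCarry i 1 _)) (moveIn-right c<n)) ⟩ᴿ
    carry (bin c) 0 _ (Stores-write-same st refl) (bitLength-mono-≤ c<n)
    where
    reads-bit : δ-parity qCount (readIn x (suc c)) (t 1) ≡ go qCarry (t 1) right stay
    reads-bit = cong (λ ι → δ-parity qCount ι (t 1)) (proj₂ (readIn-< {x} c<n))

  count : ∀ d c t → c + d ≡ n → Stores t (bin c) → counting c t ↠ halted (odd ℓ)
  count zero c t c+0≡n st =
    s≤s z≤n ⟶⟨ step-go reads-end ⟩
    scan ℓ 0 (subst (Stores _ ∘ bin) c≡n (Stores-write-same st refl)) refl
    where
    c≡n : c ≡ n
    c≡n = trans (sym (+-identityʳ c)) c+0≡n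
    reads-end : δ-parity qCount (readIn x (suc c)) (t 1) ≡ go qEven (t 1) stay stay
    reads-end = cong (λ ι → δ-parity qCount ι (t 1)) (trans (cong (readIn x ∘ suc) c≡n) (readIn-end x))
  count (suc d) c t c+1+d≡n st
    with t′ , st′ , tr ← increment (subst (c <_) c+1+d≡n (m<m+n c (s≤s z≤n))) st =
    tr ◅◅ count d (suc c) t′ (trans (sym (+-suc c d)) c+1+d≡n) st′

  computes-parity : initial bitLengthParity ↠ halted (odd ℓ)
  computes-parity = z≤n ⟶⟨ refl ⟩ count n 0 _ refl Stores-start

LengthParity-L : InL (LengthParity true)
LengthParity-L = InL-by-traces bitLengthParity (odd ∘ bitLength ∘ length) (suc ∘ bitLength ∘ length) 2
  (λ x → space≤log (length x)) (λ _ → mk⇔ id id) Run.computes-parity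
  where
  space≤log : ∀ n → suc (bitLength n) ≤ 2 * ⌊log₂ n ⌋ + 2
  space≤log n = begin
    suc (bitLength n)      ≤⟨ s≤s (bitLength≤1+⌊log₂⌋ n) ⟩
    2 + ⌊log₂ n ⌋          ≤⟨ +-monoʳ-≤ 2 (m≤m+n ⌊log₂ n ⌋ _) ⟩
    2 + 2 * ⌊log₂ n ⌋      ≡⟨ +-comm 2 _ ⟩
    2 * ⌊log₂ n ⌋ + 2      ∎
    where open ≤-Reasoning

proposition5p1 : Σ (Lang Bool) λ L →
    InL L × InREGn L × REGImmune L × REGImmune (Complement L)
proposition5p1 =
  LengthParity true , LengthParity-L , LengthParity-REGn ,
  LengthParity-REGImmune true ,
  REGImmune-cong (λ _ → mk⇔ not-¬ ¬-not) (LengthParity-REGImmune false)
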